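{- Let $\Gamma$ be a weighted digraph with Laplacian matrix $L$, numbers $\sigma_k$ and matrices $Q_k$ as in the context. Then for every $k=0,1,2,\dots$, $$Q_{k+1}=(-L)Q_k+\sigma_{k+1}I,\qquad \sigma_{k+1}=\frac{\operatorname{tr}(LQ_k)}{k+1}.$$
   Context: $\Gamma$ is a weighted digraph without loops on vertex set $\{1,\dots,n\}$, $n>1$, with strictly positive arc weights $w_{ij}$ ($w_{ij}=0$ if there is no arc $i\to j$). Its Laplacian $L=(\ell_{ij})$ has $\ell_{ij}=-w_{ij}$ for $j\ne i$, $\ell_{ii}=\sum_{k\ne i}w_{ik}$. The weight of a subgraph is the product of its arc weights (1 if no arcs); the weight of a set of subgraphs is the sum of their weights (0 if empty). A converging tree is a weakly connected digraph in which one vertex (the root) has outdegree 0 and all others outdegree 1; an in-forest of $\Gamma$ is a spanning subgraph all of whose weak components are converging trees. For $k\ge0$, $\sigma_k$ is the total weight of in-forests of $\Gamma$ with $k$ arcs, and $Q_k=(q^k_{ij})$ where $q^k_{ij}$ is the total weight of in-forests of $\Gamma$ with $k$ arcs in which $i$ belongs to the tree rooted at $j$ (so $Q_0=I$, $\sigma_0=1$). -}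

module Defs where

open import Algebra.Bundles using (CommutativeRing)
open import Data.Nat using (ℕ; zero; suc) renaming (_≡ᵇ_ to _≡ℕᵇ_)
open import Data.Bool using (Bool; true; false; if_then_else_; _∧_)
open import Data.Fin using (Fin; zero; suc)
open import Data.Fin.Properties using (_≟_)
open import Data.Maybe using (Maybe; just; nothing; _>>=_)
open import Data.List using (List; []; _∷_; map; concatMap; filterᵇ; foldr; allFin)
open import Data.Vec.Functional using () renaming (_∷_ to _∷ᵥ_)
open import Relation.Nullary.Decidable using (⌊_⌋)
open import Relation.Binary.PropositionalEquality using (_≡_)

Digraph : ℕ → Set
Digraph n = Fin n → Fin n → Bool

Loopless : ∀ {n} → Digraph n → Set
Loopless {n} A = (i : Fin n) → A i i ≡ false

-- Spanning subgraphs in which every vertex has outdegree ≤ 1 are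
-- represented by their out-arc function  p : Fin n → Maybe (Fin n):
-- p i ≡ just j  iff  the subgraph contains the arc i → j,
-- p i ≡ nothing iff  i has outdegree 0.

allᵇ : ∀ {a} {A : Set a} → (A → Bool) → List A → Bool
allᵇ f = foldr (λ x b → f x ∧ b) true

OutFun : ℕ → Set
OutFun n = Fin n → Maybe (Fin n)

allOutFuns : (n m : ℕ) → List (Fin n → Maybe (Fin m))
allOutFuns zero    m = (λ ()) ∷ []
allOutFuns (suc n) m =
  concatMap (λ b → map (λ f → b ∷ᵥ f) (allOutFuns n m))
            (nothing ∷ map just (allFin m))

-- follow the arcs t times starting from i (nothing = walked off a vertex
-- of outdegree 0)
follow : ∀ {n} → OutFun n → ℕ → Fin n → Maybe (Fin n)
follow p zero    i = just i
follow p (suc t) i = follow p t i >>= p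

step : ∀ {n} → OutFun n → Fin n → Fin n
step p i with p i
... | just j  = j
... | nothing = i

stepN : ∀ {n} → OutFun n → ℕ → Fin n → Fin n
stepN p zero    i = i
stepN p (suc t) i = step p (stepN p t i)

-- the root of the converging tree containing i (meaningful for in-forests:
-- the walk from i reaches its root, of outdegree 0, within n steps)
root : ∀ {n} → OutFun n → Fin n → Fin n
root {n} p i = stepN p n i

isNothing : ∀ {a} {A : Set a} → Maybe A → Bool
isNothing nothing  = true
isNothing (just _) = false

arcsInᵇ : ∀ {n} → Digraph n → OutFun n → Bool
arcsInᵇ {n} A p = allᵇ (λ i → arcOK i (p i)) (allFin n)
  where
  arcOK : Fin n → Maybe (Fin n) → Bool
  arcOK i nothing  = true
  arcOK i (just j) = A i j

-- every weak component is a converging tree: for a subgraph with all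
-- outdegrees ≤ 1 this says exactly that there is no directed cycle, i.e.
-- every walk along arcs stops (at a root) within n steps.
acyclicᵇ : ∀ {n} → OutFun n → Bool
acyclicᵇ {n} p = allᵇ (λ i → isNothing (follow p n i)) (allFin n)

isInForestᵇ : ∀ {n} → Digraph n → OutFun n → Bool
isInForestᵇ A p = arcsInᵇ A p ∧ acyclicᵇ p

countArcs : ∀ {n} → OutFun n → ℕ
countArcs {n} p = foldr (λ i c → if isNothing (p i) then c else suc c) 0 (allFin n)

module Weighted {c ℓ} (R : CommutativeRing c ℓ) where
  open CommutativeRing R

  sumL : List Carrier → Carrier
  sumL = foldr _+_ 0#

  Σ[_] : (n : ℕ) → (Fin n → Carrier) → Carrier
  Σ[ n ] f = sumL (map f (allFin n))

  fromℕ : ℕ → Carrier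
  fromℕ zero    = 0#
  fromℕ (suc m) = 1# + fromℕ m

  Matrix : ℕ → Set c
  Matrix n = Fin n → Fin n → Carrier

  δ : ∀ {n} → Fin n → Fin n → Bool
  δ i j = ⌊ i ≟ j ⌋

  I : ∀ {n} → Matrix n
  I i j = if δ i j then 1# else 0#

  infixl 7 _⊗_
  infixl 6 _⊕_

  _⊗_ : ∀ {n} → Matrix n → Matrix n → Matrix n
  _⊗_ {n} M N i j = Σ[ n ] (λ m → M i m * N m j)

  _⊕_ : ∀ {n} → Matrix n → Matrix n → Matrix n
  (M ⊕ N) i j = M i j + N i j

  neg : ∀ {n} → Matrix n → Matrix n
  neg M i j = - (M i j)

  scal : ∀ {n} → Carrier → Matrix n → Matrix n
  scal a M i j = a * M i j

  tr : ∀ {n} → Matrix n → Carrier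
  tr {n} M = Σ[ n ] (λ i → M i i)

  Weights : ℕ → Set c
  Weights n = Fin n → Fin n → Carrier

  W : ∀ {n} → Digraph n → Weights n → Matrix n
  W A w i j = if A i j then w i j else 0#

  Laplacian : ∀ {n} → Digraph n → Weights n → Matrix n
  Laplacian {n} A w i j =
    if δ i j then Σ[ n ] (λ k → if δ i k then 0# else W A w i k)
             else - (W A w i j)

  weight : ∀ {n} → Weights n → OutFun n → Carrier
  weight {n} w p = foldr (λ i r → arcW i (p i) * r) 1# (allFin n)
    where
    arcW : Fin n → Maybe (Fin n) → Carrier
    arcW i nothing  = 1#
    arcW i (just j) = w i j

  inForests : ∀ {n} → Digraph n → ℕ → List (OutFun n)
  inForests {n} A k =
    filterᵇ (λ p → isInForestᵇ A p ∧ (countArcs p ≡ℕᵇ k)) (allOutFuns n n)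

  σ : ∀ {n} → Digraph n → Weights n → ℕ → Carrier
  σ A w k = sumL (map (weight w) (inForests A k))

  Q : ∀ {n} → Digraph n → Weights n → ℕ → Matrix n
  Q A w k i j =
    sumL (map (weight w) (filterᵇ (λ p → δ (root p i) j) (inForests A k)))

{-# OPTIONS --safe #-}
module Submission where

-- Every entry of Q_{k+1}, σ_{k+1} I and (-L) Q_k is a sum over out-functions q (all out-degrees
-- ≤ 1) of w(q), guarded by "q is an in-forest with the right number of arcs".  Fix the row i and
-- write q as p [ i ]≔ b, where i is a root of p and b is nothing or an arc i → m.  Attaching
-- i → m to an in-forest p gives an in-forest iff m is attachable (i → m is an arc of Γ and the
-- tree of m in p is not rooted at i); the tree of i then hangs below root_p(m).  So Q_{k+1}(i,j)
-- sees p itself (if i = j) and Σ_m w_im [root_p(m) = j] w(p) over attachable m, whereas row i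
-- of -L expands as Σ_x w_ix (Q_k(x,j) - Q_k(i,j)).  On in-forests p with k arcs the two agree
-- up to the diagonal term σ_{k+1} δ_ij; on those with k - 1 arcs what is left,
-- Σ_{m,x} w_im w_ix ([root(x) = j] - [root(m) = j]) over attachable m and x, vanishes by
-- antisymmetry.  Taking j = i and summing over i gives the trace identity, since an in-forest
-- with k + 1 arcs has exactly n - k - 1 roots.

open import Defs
open import Algebra.Bundles using (CommutativeRing; CommutativeMonoid)
import Data.Nat as ℕ
open ℕ using (ℕ; zero; suc; _∸_; _≤_; _<_)
open import Data.Nat.Properties
  using (≤-total; m≤m*n; m≤m+n; n<1+n; m∸n+n≡m; +-suc; ≡ᵇ⇒≡; +-0-commutativeMonoid)
open import Data.Fin using (Fin; zero; suc; toℕ)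
open import Data.Fin.Properties using (_≟_; pigeonhole; toℕ≤pred[n])
open import Data.Bool using (Bool; true; false; if_then_else_; _∧_; not; T)
open import Data.Bool.Properties using (∧-commutativeMonoid; ∧-comm; ∧-zeroʳ; T-∧; T-≡)
open import Data.Maybe using (Maybe; just; nothing; maybe; _>>=_)
open import Data.List using (List; []; _∷_; _++_; foldr; map; concatMap; filterᵇ; allFin)
open import Data.List.Properties using (foldr-cong; foldr-map; map-tabulate; map-∘; map-cong)
open import Data.Vec.Functional using (Vector; updateAt) renaming (_∷_ to _∷ᵥ_)
open import Data.Vec.Functional.Properties using (updateAt-updates; updateAt-minimal; updateAt-id-local)
open import Data.Product using (∃-syntax; _×_; _,_; proj₁; proj₂)
open import Data.Sum using (inj₁; inj₂)
open import Data.Empty using (⊥-elim)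
open import Data.Unit using (tt)
open import Level using (Level)
open import Function using (_∘_; id; const; _⇔_; mk⇔; Equivalence)
open Equivalence using (to; from)
open import Relation.Nullary using (yes; no)
open import Relation.Nullary.Decidable
  using (⌊_⌋; fromWitnessFalse; toWitnessFalse; isYes≗does; dec-true; ⌊⌋-map′)
open import Relation.Binary.PropositionalEquality
  using (_≡_; _≢_; _≗_; refl; sym; trans; cong; cong₂; subst; module ≡-Reasoning)

private variable
  n : ℕ

_[_]≔_ : ∀ {a} {A : Set a} → Vector A n → Fin n → A → Vector A n
p [ i ]≔ b = updateAt p i (const b)

-- `weight` and `arcsInᵇ` fold a function local to a `where` block of Defs; unifying the fold
-- with `foldr h z xs` is the only way to refer to that function.
stepOf : ∀ {a b} {A : Set a} {B : Set b} (z : B) (xs : List A) (v : B) (h : A → B → B) →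
         v ≡ foldr h z xs → A → B → B
stepOf _ _ _ h _ = h

module Fold {c ℓ} (M : CommutativeMonoid c ℓ) where
  open CommutativeMonoid M renaming (refl to ≈-refl; sym to ≈-sym; trans to ≈-trans)
  open import Algebra.Properties.CommutativeSemigroup commutativeSemigroup using (x∙yz≈y∙xz)
  open import Relation.Binary.Reasoning.Setoid setoid

  ⨁ : (Fin n → Carrier) → Carrier
  ⨁ {n} f = foldr (λ x r → f x ∙ r) ε (allFin n)

  ⨁-suc : (f : Fin (suc n) → Carrier) → ⨁ f ≡ f zero ∙ ⨁ (f ∘ suc)
  ⨁-suc {n} f = cong (f zero ∙_)
    (trans (cong (foldr f∙ ε) (sym (map-tabulate id suc))) (foldr-map f∙ suc ε (allFin n)))
    where
    f∙ : Fin (suc n) → Carrier → Carrier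
    f∙ x r = f x ∙ r

  ⨁-cong : {f g : Fin n → Carrier} → (∀ x → f x ≡ g x) → ⨁ f ≡ ⨁ g
  ⨁-cong {n} f≗g = foldr-cong (λ x r → cong (_∙ r) (f≗g x)) refl (allFin n)

  ⨁-update : ∀ {a} {A : Set a} (h : Fin n → A → Carrier) (p : Vector A n) i b →
             h i (p i) ≈ ε → ⨁ (λ x → h x ((p [ i ]≔ b) x)) ≈ h i b ∙ ⨁ (λ x → h x (p x))
  ⨁-update {suc n} h p zero b hᵢ≈ε = begin
    ⨁ (λ x → h x ((p [ zero ]≔ b) x))
      ≡⟨ ⨁-suc (λ x → h x ((p [ zero ]≔ b) x)) ⟩
    h zero b ∙ ⨁ (λ x → h (suc x) (p (suc x)))
      ≈⟨ ∙-congˡ (identityˡ _) ⟨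
    h zero b ∙ (ε ∙ ⨁ (λ x → h (suc x) (p (suc x))))
      ≈⟨ ∙-congˡ (∙-congʳ hᵢ≈ε) ⟨
    h zero b ∙ (h zero (p zero) ∙ ⨁ (λ x → h (suc x) (p (suc x))))
      ≡⟨ cong (h zero b ∙_) (⨁-suc (λ x → h x (p x))) ⟨
    h zero b ∙ ⨁ (λ x → h x (p x)) ∎
  ⨁-update {suc n} h p (suc i) b hᵢ≈ε = begin
    ⨁ (λ x → h x ((p [ suc i ]≔ b) x))
      ≡⟨ ⨁-suc (λ x → h x ((p [ suc i ]≔ b) x)) ⟩
    h zero (p zero) ∙ ⨁ (λ x → h (suc x) (((p ∘ suc) [ i ]≔ b) x))
      ≈⟨ ∙-congˡ (⨁-update (h ∘ suc) (p ∘ suc) i b hᵢ≈ε) ⟩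
    h zero (p zero) ∙ (h (suc i) b ∙ ⨁ (λ x → h (suc x) (p (suc x))))
      ≈⟨ x∙yz≈y∙xz _ _ _ ⟩
    h (suc i) b ∙ (h zero (p zero) ∙ ⨁ (λ x → h (suc x) (p (suc x))))
      ≡⟨ cong (h (suc i) b ∙_) (⨁-suc (λ x → h x (p x))) ⟨
    h (suc i) b ∙ ⨁ (λ x → h x (p x)) ∎

-- Walks along an out-function

module _ (p : OutFun n) where

  follow-just-+ : ∀ t {s x y} → follow p s x ≡ just y → follow p (t ℕ.+ s) x ≡ follow p t y
  follow-just-+ zero    e = e
  follow-just-+ (suc t) e = cong (_>>= p) (follow-just-+ t e)

  follow-nothing-+ : ∀ t {s x} → follow p s x ≡ nothing → follow p (t ℕ.+ s) x ≡ nothing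
  follow-nothing-+ zero    e = e
  follow-nothing-+ (suc t) e = cong (_>>= p) (follow-nothing-+ t e)

  follow-nothing-mono : ∀ {s u x} → s ≤ u → follow p s x ≡ nothing → follow p u x ≡ nothing
  follow-nothing-mono {s} {u} {x} s≤u e =
    subst (λ v → follow p v x ≡ nothing) (m∸n+n≡m s≤u) (follow-nothing-+ (u ∸ s) e)

  follow-just-≤ : ∀ {s u x y} → s ≤ u → follow p u x ≡ just y → ∃[ z ] follow p s x ≡ just z
  follow-just-≤ {s} {x = x} s≤u e with follow p s x in eqₛ
  ... | just z  = z , refl
  ... | nothing with () ← trans (sym e) (follow-nothing-mono s≤u eqₛ)

  follow-cycle : ∀ {c y} → follow p (suc c) y ≡ just y → ∀ q → follow p (q ℕ.* suc c) y ≡ just y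
  follow-cycle     e zero    = refl
  follow-cycle {c} e (suc q) = trans (follow-just-+ (suc c) (follow-cycle e q)) e

  cycle⇒follow≢nothing : ∀ {c y} → follow p (suc c) y ≡ just y → ∀ s → follow p s y ≢ nothing
  cycle⇒follow≢nothing {c} e s e′
    with () ← trans (sym (follow-cycle e s)) (follow-nothing-mono (m≤m*n s (suc c)) e′)

  revisit⇒follow≢nothing : ∀ {a b x y} → a < b → follow p a x ≡ just y → follow p b x ≡ just y →
                           ∀ t → follow p t x ≢ nothing
  revisit⇒follow≢nothing {a} {b} {x} {y} a<b ea eb t e = cycle⇒follow≢nothing {c} loop t dead
    where
    c : ℕ
    c = b ∸ suc a
    b≡ : b ≡ suc c ℕ.+ a
    b≡ = trans (sym (m∸n+n≡m a<b)) (+-suc c a)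
    loop : follow p (suc c) y ≡ just y
    loop = trans (sym (follow-just-+ (suc c) ea)) (subst (λ v → follow p v x ≡ just y) b≡ eb)
    dead : follow p t y ≡ nothing
    dead = trans (sym (follow-just-+ t ea)) (follow-nothing-mono (m≤m+n t a) e)

  follow-just⇒stepN : ∀ s {x y} → follow p s x ≡ just y → stepN p s x ≡ y
  follow-just⇒stepN zero    refl = refl
  follow-just⇒stepN (suc s) {x} e with follow p s x in eq
  ... | just y rewrite follow-just⇒stepN s eq | e = refl

  stepN-+ : ∀ t s x → stepN p (t ℕ.+ s) x ≡ stepN p t (stepN p s x)
  stepN-+ zero    s x = refl
  stepN-+ (suc t) s x = cong (step p) (stepN-+ t s x)

  stepN-sink : ∀ {x} → p x ≡ nothing → ∀ t → stepN p t x ≡ x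
  stepN-sink e zero = refl
  stepN-sink {x} e (suc t) rewrite stepN-sink e t | e = refl

  -- Pigeonhole: the n + 1 positions reached within n steps cannot all be distinct.
  follow-nothing-within : ∀ t {x} → follow p t x ≡ nothing → follow p n x ≡ nothing
  follow-nothing-within t {x} e with follow p n x in eqₙ
  ... | nothing = refl
  ... | just _ with pigeonhole (n<1+n n) (λ s → stepN p (toℕ s) x)
  ... | a , b , a<b , same with follow-just-≤ (toℕ≤pred[n] a) eqₙ | follow-just-≤ (toℕ≤pred[n] b) eqₙ
  ... | ya , ea | yb , eb = ⊥-elim (revisit⇒follow≢nothing a<b ea (trans eb (cong just yb≡ya)) t e)
    where
    yb≡ya : yb ≡ ya
    yb≡ya = trans (sym (follow-just⇒stepN (toℕ b) eb)) (trans (sym same) (follow-just⇒stepN (toℕ a) ea))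

  RootOf : Fin n → Fin n → Set
  RootOf x r = ∃[ t ] follow p t x ≡ just r × p r ≡ nothing

  nothing⇒RootOf : ∀ t {x} → follow p t x ≡ nothing → ∃[ r ] RootOf x r
  nothing⇒RootOf (suc t) {x} e with follow p t x in eq
  ... | nothing = nothing⇒RootOf t eq
  ... | just r  = r , t , eq , e

  RootOf⇒terminates : ∀ {x r} → RootOf x r → follow p n x ≡ nothing
  RootOf⇒terminates (t , e , sink) = follow-nothing-within (suc t) (trans (cong (_>>= p) e) sink)

  RootOf⇒root≡ : ∀ {x r} → RootOf x r → root p x ≡ r
  RootOf⇒root≡ {x} {r} ro@(t , e , sink) with ≤-total t n
  ... | inj₂ n≤t with () ← trans (sym e) (follow-nothing-mono n≤t (RootOf⇒terminates ro))
  ... | inj₁ t≤n = begin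
    stepN p n x                    ≡⟨ cong (λ v → stepN p v x) (m∸n+n≡m t≤n) ⟨
    stepN p (n ∸ t ℕ.+ t) x        ≡⟨ stepN-+ (n ∸ t) t x ⟩
    stepN p (n ∸ t) (stepN p t x)  ≡⟨ cong (stepN p (n ∸ t)) (follow-just⇒stepN t e) ⟩
    stepN p (n ∸ t) r              ≡⟨ stepN-sink sink (n ∸ t) ⟩
    r                              ∎
    where open ≡-Reasoning

  Acyclic : Set
  Acyclic = ∀ x → follow p n x ≡ nothing

  root-RootOf : Acyclic → ∀ x → RootOf x (root p x)
  root-RootOf ac x with r , ro ← nothing⇒RootOf n (ac x) = subst (RootOf x) (sym (RootOf⇒root≡ ro)) ro

  root-sink : Acyclic → ∀ x → p (root p x) ≡ nothing
  root-sink ac x = proj₂ (proj₂ (root-RootOf ac x))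

  root-of-sink : ∀ {x} → p x ≡ nothing → root p x ≡ x
  root-of-sink e = stepN-sink e n

  root-fixed⇔sink : Acyclic → ∀ x → ⌊ root p x ≟ x ⌋ ≡ isNothing (p x)
  root-fixed⇔sink ac x with p x in e
  ... | nothing rewrite root-of-sink e = trans (isYes≗does (x ≟ x)) (dec-true (x ≟ x) refl)
  ... | just _ with root p x ≟ x
  ...   | no _     = refl
  ...   | yes rₓ≡x with () ← trans (sym e) (subst (λ r → p r ≡ nothing) rₓ≡x (root-sink ac x))

-- Attaching an arc at a root

module _ (p : OutFun n) {i : Fin n} (pᵢ : p i ≡ nothing) where

  follow-update : ∀ b s {x y} → follow p s x ≡ just y → follow (p [ i ]≔ b) s x ≡ just y
  follow-update b zero    e = e
  follow-update b (suc s) {x} e with follow p s x in eq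
  ... | just y = trans (cong (_>>= (p [ i ]≔ b)) (follow-update b s eq)) (trans (updateAt-minimal y i p y≢i) e)
    where
    y≢i : y ≢ i
    y≢i refl with () ← trans (sym e) pᵢ

  module _ (m : Fin n) where

    reroot : Fin n → Fin n
    reroot x = if ⌊ root p x ≟ i ⌋ then root p m else root p x

    follow-attach-to-i : ∀ t {x} → follow p t x ≡ just i → follow (p [ i ]≔ just m) (suc t) x ≡ just m
    follow-attach-to-i t e = trans (cong (_>>= (p [ i ]≔ just m)) (follow-update _ t e)) (updateAt-updates i p)

    attach-RootOf : Acyclic p → root p m ≢ i → ∀ x → RootOf (p [ i ]≔ just m) x (reroot x)
    attach-RootOf ac rₘ≢i x with root p x ≟ i | root-RootOf p ac x
    ... | no rₓ≢i | t , e , sink =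
      t , follow-update _ t e , trans (updateAt-minimal _ i p rₓ≢i) sink
    ... | yes rₓ≡i | t , e , _ with t′ , e′ , sink′ ← root-RootOf p ac m =
      t′ ℕ.+ suc t ,
      trans (follow-just-+ _ t′ (follow-attach-to-i t (trans e (cong just rₓ≡i)))) (follow-update _ t′ e′) ,
      trans (updateAt-minimal _ i p rₘ≢i) sink′

    root-attach : Acyclic p → root p m ≢ i → ∀ x → root (p [ i ]≔ just m) x ≡ reroot x
    root-attach ac rₘ≢i x = RootOf⇒root≡ _ (attach-RootOf ac rₘ≢i x)

    attach-acyclic⇔ : Acyclic (p [ i ]≔ just m) ⇔ (Acyclic p × root p m ≢ i)
    attach-acyclic⇔ = mk⇔ (λ ac → acyclic ac , no-cycle ac)
                          (λ (ac , rₘ≢i) x → RootOf⇒terminates _ (attach-RootOf ac rₘ≢i x))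
      where
      acyclic : Acyclic (p [ i ]≔ just m) → Acyclic p
      acyclic ac x with follow p n x in eq
      ... | nothing = refl
      ... | just y with () ← trans (sym (follow-update _ n eq)) (ac x)
      no-cycle : Acyclic (p [ i ]≔ just m) → root p m ≢ i
      no-cycle ac rₘ≡i with t , e , _ ← root-RootOf p (acyclic ac) m =
        cycle⇒follow≢nothing _ {t} (follow-attach-to-i t (trans e (cong just rₘ≡i))) n (ac m)

-- In-forests as Boolean tests

module ⋀ = Fold ∧-commutativeMonoid
module ∑ℕ = Fold +-0-commutativeMonoid

T-injective : ∀ {a b} → (T a ⇔ T b) → a ≡ b
T-injective {false} {false} _   = refl
T-injective {false} {true}  a⇔b with () ← a⇔b .from tt
T-injective {true}  {false} a⇔b with () ← a⇔b .to tt
T-injective {true}  {true}  _   = refl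

T-⋀ : (f : Fin n → Bool) → T (⋀.⨁ f) ⇔ (∀ x → T (f x))
T-⋀ {zero}  f = mk⇔ (λ _ ()) (const tt)
T-⋀ {suc n} f rewrite ⋀.⨁-suc f = mk⇔
  (λ t → let (t₀ , tₛ) = T-∧ .to t in λ { zero → t₀ ; (suc x) → T-⋀ (f ∘ suc) .to tₛ x })
  (λ h → T-∧ .from (h zero , T-⋀ (f ∘ suc) .from (h ∘ suc)))

T-isNothing : ∀ {a} {A : Set a} {b : Maybe A} → T (isNothing b) ⇔ b ≡ nothing
T-isNothing {b = nothing} = mk⇔ (const refl) (const tt)
T-isNothing {b = just _}  = mk⇔ (λ ()) (λ ())

T-acyclicᵇ : (p : OutFun n) → T (acyclicᵇ p) ⇔ Acyclic p
T-acyclicᵇ p = mk⇔ (λ t x → T-isNothing .to (T-⋀ _ .to t x))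
                   (λ ac → T-⋀ _ .from (λ x → T-isNothing .from (ac x)))

acyclicᵇ-attach : (p : OutFun n) {i : Fin n} → p i ≡ nothing → ∀ m →
                  acyclicᵇ (p [ i ]≔ just m) ≡ acyclicᵇ p ∧ not ⌊ root p m ≟ i ⌋
acyclicᵇ-attach p pᵢ m = T-injective (mk⇔
  (λ t → let (ac , rₘ≢i) = attach-acyclic⇔ p pᵢ m .to (T-acyclicᵇ _ .to t)
         in T-∧ .from (T-acyclicᵇ p .from ac , fromWitnessFalse rₘ≢i))
  (λ t → let (t₁ , t₂) = T-∧ .to t
         in T-acyclicᵇ _ .from (attach-acyclic⇔ p pᵢ m .from (T-acyclicᵇ p .to t₁ , toWitnessFalse t₂))))

arcInᵇ : Digraph n → Fin n → Maybe (Fin n) → Bool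
arcInᵇ A x = maybe (A x) true

arcsInᵇ-step : ∀ {n} (A : Digraph n) (p : OutFun n) x c →
               stepOf true (allFin n) (arcsInᵇ A p) _ refl x c ≡ (arcInᵇ A x (p x) ∧ c)
arcsInᵇ-step A p x c with p x
... | nothing = refl
... | just _  = refl

arcsInᵇ≡⋀ : (A : Digraph n) (p : OutFun n) → arcsInᵇ A p ≡ ⋀.⨁ (λ x → arcInᵇ A x (p x))
arcsInᵇ≡⋀ {n} A p = foldr-cong (arcsInᵇ-step A p) refl (allFin n)

arcsInᵇ-attach : (A : Digraph n) (p : OutFun n) {i : Fin n} → p i ≡ nothing → ∀ m →
                 arcsInᵇ A (p [ i ]≔ just m) ≡ A i m ∧ arcsInᵇ A p
arcsInᵇ-attach A p {i} pᵢ m = begin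
  arcsInᵇ A (p [ i ]≔ just m)
    ≡⟨ arcsInᵇ≡⋀ A (p [ i ]≔ just m) ⟩
  ⋀.⨁ (λ x → arcInᵇ A x ((p [ i ]≔ just m) x))
    ≡⟨ ⋀.⨁-update (arcInᵇ A) p i (just m) (cong (arcInᵇ A i) pᵢ) ⟩
  A i m ∧ ⋀.⨁ (λ x → arcInᵇ A x (p x))
    ≡⟨ cong (A i m ∧_) (arcsInᵇ≡⋀ A p) ⟨
  A i m ∧ arcsInᵇ A p ∎
  where open ≡-Reasoning

attachableᵇ : Digraph n → OutFun n → Fin n → Fin n → Bool
attachableᵇ A p i m = A i m ∧ not ⌊ root p m ≟ i ⌋

attachable⇒root≢ : (A : Digraph n) (p : OutFun n) {i m : Fin n} → T (attachableᵇ A p i m) → root p m ≢ i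
attachable⇒root≢ A p {i} {m} t = toWitnessFalse {a? = root p m ≟ i} (proj₂ (T-∧ {A i m} .to t))

isInForestᵇ-attach : (A : Digraph n) (p : OutFun n) {i : Fin n} → p i ≡ nothing → ∀ m →
                     isInForestᵇ A (p [ i ]≔ just m) ≡ isInForestᵇ A p ∧ attachableᵇ A p i m
isInForestᵇ-attach A p {i} pᵢ m = begin
  isInForestᵇ A (p [ i ]≔ just m)
    ≡⟨ cong₂ _∧_ (arcsInᵇ-attach A p pᵢ m) (acyclicᵇ-attach p pᵢ m) ⟩
  (A i m ∧ arcsInᵇ A p) ∧ (acyclicᵇ p ∧ not ⌊ root p m ≟ i ⌋)
    ≡⟨ cong (_∧ _) (∧-comm (A i m) _) ⟩
  (arcsInᵇ A p ∧ A i m) ∧ (acyclicᵇ p ∧ not ⌊ root p m ≟ i ⌋)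
    ≡⟨ interchange (arcsInᵇ A p) (A i m) (acyclicᵇ p) _ ⟩
  isInForestᵇ A p ∧ attachableᵇ A p i m ∎
  where
  open ≡-Reasoning
  open import Algebra.Properties.CommutativeSemigroup (CommutativeMonoid.commutativeSemigroup ∧-commutativeMonoid)
    using (interchange)

isInForestᵇ⇒Acyclic : (A : Digraph n) (p : OutFun n) → T (isInForestᵇ A p) → Acyclic p
isInForestᵇ⇒Acyclic A p t = T-acyclicᵇ p .to (proj₂ (T-∧ .to t))

arcCount : ∀ {a} {A : Set a} → Maybe A → ℕ
arcCount b = if isNothing b then 0 else 1

countArcs≡⨁ : (p : OutFun n) → countArcs p ≡ ∑ℕ.⨁ (λ x → arcCount (p x))
countArcs≡⨁ {n} p = foldr-cong (λ x c → step≡ (isNothing (p x)) c) refl (allFin n)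
  where
  step≡ : ∀ β c → (if β then c else suc c) ≡ (if β then 0 else 1) ℕ.+ c
  step≡ true  c = refl
  step≡ false c = refl

countArcs-attach : (p : OutFun n) {i : Fin n} → p i ≡ nothing → ∀ m →
                   countArcs (p [ i ]≔ just m) ≡ suc (countArcs p)
countArcs-attach p {i} pᵢ m = begin
  countArcs (p [ i ]≔ just m)
    ≡⟨ countArcs≡⨁ (p [ i ]≔ just m) ⟩
  ∑ℕ.⨁ (λ x → arcCount ((p [ i ]≔ just m) x))
    ≡⟨ ∑ℕ.⨁-update (λ _ → arcCount) p i (just m) (cong arcCount pᵢ) ⟩
  1 ℕ.+ ∑ℕ.⨁ (λ x → arcCount (p x))
    ≡⟨ cong suc (countArcs≡⨁ p) ⟨
  suc (countArcs p) ∎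
  where open ≡-Reasoning

module _ {p q : OutFun n} (p≗q : p ≗ q) where

  follow-cong : ∀ t x → follow p t x ≡ follow q t x
  follow-cong zero    x = refl
  follow-cong (suc t) x rewrite follow-cong t x with follow q t x
  ... | nothing = refl
  ... | just y  = p≗q y

  step-cong : ∀ x → step p x ≡ step q x
  step-cong x with p x | q x | p≗q x
  ... | nothing | _ | refl = refl
  ... | just _  | _ | refl = refl

  stepN-cong : ∀ t x → stepN p t x ≡ stepN q t x
  stepN-cong zero    x = refl
  stepN-cong (suc t) x = trans (cong (step p) (stepN-cong t x)) (step-cong (stepN q t x))

  root-cong : ∀ x → root p x ≡ root q x
  root-cong = stepN-cong n

  isInForestᵇ-cong : (A : Digraph n) → isInForestᵇ A p ≡ isInForestᵇ A q
  isInForestᵇ-cong A = cong₂ _∧_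
    (trans (arcsInᵇ≡⋀ A p) (trans (⋀.⨁-cong (λ x → cong (arcInᵇ A x) (p≗q x))) (sym (arcsInᵇ≡⋀ A q))))
    (⋀.⨁-cong (λ x → cong isNothing (follow-cong n x)))

  countArcs-cong : countArcs p ≡ countArcs q
  countArcs-cong =
    trans (countArcs≡⨁ p) (trans (∑ℕ.⨁-cong (λ x → cong arcCount (p≗q x))) (sym (countArcs≡⨁ q)))

-- Finite sums in a commutative ring

module Sums {c ℓ} (R : CommutativeRing c ℓ) where
  open CommutativeRing R renaming (refl to ≈-refl; sym to ≈-sym; trans to ≈-trans) hiding (zero)
  open Weighted R
  open import Algebra.Properties.CommutativeSemigroup +-commutativeSemigroup using (interchange)
  open import Algebra.Properties.CommutativeSemigroup *-commutativeSemigroup using (x∙yz≈yx∙z)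
  open import Algebra.Properties.AbelianGroup +-abelianGroup using (⁻¹-∙-comm)
  open import Algebra.Properties.Group +-group using (ε⁻¹≈ε; //-rightDividesˡ)
  open import Algebra.Properties.Ring ring using (x[y-z]≈xy-xz)
  open import Relation.Binary.Reasoning.Setoid setoid

  private variable
    a₁ a₂ : Level
    U V : Set a₁

  ∑ : List U → (U → Carrier) → Carrier
  ∑ xs g = sumL (map g xs)

  ∑-cong : ∀ xs {g h : U → Carrier} → (∀ x → g x ≈ h x) → ∑ xs g ≈ ∑ xs h
  ∑-cong []       g≈h = ≈-refl
  ∑-cong (x ∷ xs) g≈h = +-cong (g≈h x) (∑-cong xs g≈h)

  ∑-0 : ∀ xs {g : U → Carrier} → (∀ x → g x ≈ 0#) → ∑ xs g ≈ 0#
  ∑-0 []       g≈0 = ≈-refl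
  ∑-0 (x ∷ xs) g≈0 = ≈-trans (+-cong (g≈0 x) (∑-0 xs g≈0)) (+-identityˡ 0#)

  ∑-+ : ∀ xs (g h : U → Carrier) → ∑ xs (λ x → g x + h x) ≈ ∑ xs g + ∑ xs h
  ∑-+ []       g h = ≈-sym (+-identityˡ 0#)
  ∑-+ (x ∷ xs) g h = ≈-trans (+-congˡ (∑-+ xs g h)) (interchange (g x) (h x) _ _)

  ∑-*ˡ : ∀ xs a (g : U → Carrier) → ∑ xs (λ x → a * g x) ≈ a * ∑ xs g
  ∑-*ˡ []       a g = ≈-sym (zeroʳ a)
  ∑-*ˡ (x ∷ xs) a g = ≈-trans (+-congˡ (∑-*ˡ xs a g)) (≈-sym (distribˡ a (g x) _))

  ∑-*ʳ : ∀ xs a (g : U → Carrier) → ∑ xs (λ x → g x * a) ≈ ∑ xs g * a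
  ∑-*ʳ xs a g = ≈-trans (∑-cong xs (λ x → *-comm (g x) a)) (≈-trans (∑-*ˡ xs a g) (*-comm a _))

  ∑-neg : ∀ xs (g : U → Carrier) → ∑ xs (λ x → - g x) ≈ - ∑ xs g
  ∑-neg []       g = ≈-sym ε⁻¹≈ε
  ∑-neg (x ∷ xs) g = ≈-trans (+-congˡ (∑-neg xs g)) (⁻¹-∙-comm (g x) _)

  ∑-++ : ∀ xs ys (g : U → Carrier) → ∑ (xs ++ ys) g ≈ ∑ xs g + ∑ ys g
  ∑-++ []       ys g = ≈-sym (+-identityˡ _)
  ∑-++ (x ∷ xs) ys g = ≈-trans (+-congˡ (∑-++ xs ys g)) (≈-sym (+-assoc _ _ _))

  ∑-comm : ∀ xs (ys : List V) (g : U → V → Carrier) →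
           ∑ xs (λ x → ∑ ys (g x)) ≈ ∑ ys (λ y → ∑ xs (λ x → g x y))
  ∑-comm []       ys g = ≈-sym (∑-0 ys (λ _ → ≈-refl))
  ∑-comm (x ∷ xs) ys g =
    ≈-trans (+-congˡ (∑-comm xs ys g)) (≈-sym (∑-+ ys (g x) (λ y → ∑ xs (λ x → g x y))))

  ∑-map : ∀ (f : V → U) ys (g : U → Carrier) → ∑ (map f ys) g ≡ ∑ ys (g ∘ f)
  ∑-map f ys g = cong sumL (sym (map-∘ ys))

  ∑-concatMap : ∀ (f : V → List U) ys (g : U → Carrier) →
                ∑ (concatMap f ys) g ≈ ∑ ys (λ y → ∑ (f y) g)
  ∑-concatMap f []       g = ≈-refl
  ∑-concatMap f (y ∷ ys) g = ≈-trans (∑-++ (f y) (concatMap f ys) g) (+-congˡ (∑-concatMap f ys g))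

  ∑-antisymmetric : ∀ xs (f : U → U → Carrier) (b : U → Carrier) → (∀ m x → f m x ≈ f x m) →
                    ∑ xs (λ m → ∑ xs (λ x → f m x * (b x - b m))) ≈ 0#
  ∑-antisymmetric xs f b f-sym = begin
    ∑ xs (λ m → ∑ xs (λ x → f m x * (b x - b m)))
      ≈⟨ ∑-cong xs (λ m → ∑-cong xs (λ x → x[y-z]≈xy-xz (f m x) (b x) (b m))) ⟩
    ∑ xs (λ m → ∑ xs (λ x → f m x * b x - f m x * b m))
      ≈⟨ ∑-cong xs (λ m → ≈-trans (∑-+ xs _ _) (+-congˡ (∑-neg xs _))) ⟩
    ∑ xs (λ m → ∑ xs (λ x → f m x * b x) - ∑ xs (λ x → f m x * b m))
      ≈⟨ ≈-trans (∑-+ xs _ _) (+-congˡ (∑-neg xs _)) ⟩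
    S - ∑ xs (λ m → ∑ xs (λ x → f m x * b m))
      ≈⟨ +-congˡ (-‿cong (∑-comm xs xs (λ m x → f m x * b m))) ⟩
    S - ∑ xs (λ x → ∑ xs (λ m → f m x * b m))
      ≈⟨ +-congˡ (-‿cong (∑-cong xs (λ x → ∑-cong xs (λ m → *-congʳ (f-sym m x))))) ⟩
    S - S
      ≈⟨ -‿inverseʳ S ⟩
    0# ∎
    where
    S : Carrier
    S = ∑ xs (λ m → ∑ xs (λ x → f m x * b x))

  -- b ▹ x is the Iverson-bracket product [b] x.
  infixr 5 _▹_
  _▹_ : Bool → Carrier → Carrier
  b ▹ x = if b then x else 0#

  ▹-cong : ∀ b {x y} → (T b → x ≈ y) → b ▹ x ≈ b ▹ y
  ▹-cong true  x≈y = x≈y tt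
  ▹-cong false _   = ≈-refl

  ▹-∧ : ∀ a b x → (a ∧ b) ▹ x ≡ a ▹ b ▹ x
  ▹-∧ true  b x = refl
  ▹-∧ false b x = refl

  ▹-comm : ∀ a b x → a ▹ b ▹ x ≡ b ▹ a ▹ x
  ▹-comm true  b     x = refl
  ▹-comm false true  x = refl
  ▹-comm false false x = refl

  ▹-0 : ∀ b → b ▹ 0# ≡ 0#
  ▹-0 true  = refl
  ▹-0 false = refl

  ▹-+ : ∀ b x y → b ▹ x + y ≈ (b ▹ x) + (b ▹ y)
  ▹-+ true  x y = ≈-refl
  ▹-+ false x y = ≈-sym (+-identityˡ 0#)

  ▹-*ˡ : ∀ b x y → x * (b ▹ y) ≈ b ▹ x * y
  ▹-*ˡ true  x y = ≈-refl
  ▹-*ˡ false x y = zeroʳ x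

  ▹-1 : ∀ b x → b ▹ x ≈ x * (b ▹ 1#)
  ▹-1 true  x = ≈-sym (*-identityʳ x)
  ▹-1 false x = ≈-sym (zeroʳ x)

  ▹-split : ∀ β γ u v → β ▹ u * v ≈ u * ((β ▹ v) - (γ ▹ v)) + (γ ▹ u * v)
  ▹-split β γ u v = begin
    β ▹ u * v                                ≈⟨ ▹-*ˡ β u v ⟨
    u * (β ▹ v)                              ≈⟨ *-congˡ (//-rightDividesˡ (γ ▹ v) (β ▹ v)) ⟨
    u * (((β ▹ v) - (γ ▹ v)) + (γ ▹ v))      ≈⟨ distribˡ u _ _ ⟩
    u * ((β ▹ v) - (γ ▹ v)) + u * (γ ▹ v)    ≈⟨ +-congˡ (▹-*ˡ γ u v) ⟩
    u * ((β ▹ v) - (γ ▹ v)) + (γ ▹ u * v)    ∎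

  ▹-difference : ∀ β γ u v t →
                 u * ((β ▹ v * t) - (γ ▹ v * t)) ≈ ((v * u) * t) * ((β ▹ 1#) - (γ ▹ 1#))
  ▹-difference β γ u v t = begin
    u * ((β ▹ v * t) - (γ ▹ v * t))                ≈⟨ *-congˡ (+-cong (▹-1 β _) (-‿cong (▹-1 γ _))) ⟩
    u * ((v * t) * (β ▹ 1#) - (v * t) * (γ ▹ 1#))  ≈⟨ *-congˡ (x[y-z]≈xy-xz (v * t) _ _) ⟨
    u * ((v * t) * ((β ▹ 1#) - (γ ▹ 1#)))          ≈⟨ *-assoc u (v * t) _ ⟨
    (u * (v * t)) * ((β ▹ 1#) - (γ ▹ 1#))          ≈⟨ *-congʳ (x∙yz≈yx∙z u v t) ⟩
    ((v * u) * t) * ((β ▹ 1#) - (γ ▹ 1#))          ∎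

  ∑-▹ : ∀ xs b (g : U → Carrier) → ∑ xs (λ x → b ▹ g x) ≈ b ▹ ∑ xs g
  ∑-▹ xs true  g = ≈-refl
  ∑-▹ xs false g = ∑-0 xs (λ _ → ≈-refl)

  ∑-*-▹ : ∀ xs b (u g : U → Carrier) → ∑ xs (λ x → u x * (b ▹ g x)) ≈ b ▹ ∑ xs (λ x → u x * g x)
  ∑-*-▹ xs b u g = ≈-trans (∑-cong xs (λ x → ▹-*ˡ b (u x) (g x))) (∑-▹ xs b _)

  ∑-filterᵇ : ∀ (P : U → Bool) xs (g : U → Carrier) →
              sumL (map g (filterᵇ P xs)) ≈ ∑ xs (λ x → P x ▹ g x)
  ∑-filterᵇ P []       g = ≈-refl
  ∑-filterᵇ P (x ∷ xs) g with P x
  ... | true  = +-congˡ (∑-filterᵇ P xs g)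
  ... | false = ≈-trans (∑-filterᵇ P xs g) (≈-sym (+-identityˡ _))

  Σ-suc : (h : Fin (suc n) → Carrier) → Σ[ suc n ] h ≡ h zero + Σ[ n ] (h ∘ suc)
  Σ-suc h = cong (λ xs → h zero + sumL xs) (trans (map-tabulate suc h) (sym (map-tabulate id (h ∘ suc))))

  Σ-δ : (i : Fin n) (h : Fin n → Carrier) → Σ[ n ] (λ x → δ i x ▹ h x) ≈ h i
  Σ-δ {suc n} zero h = begin
    Σ[ suc n ] (λ x → δ zero x ▹ h x)  ≡⟨ Σ-suc (λ x → δ zero x ▹ h x) ⟩
    h zero + Σ[ n ] (λ _ → 0#)         ≈⟨ +-congˡ (∑-0 (allFin n) (λ _ → ≈-refl)) ⟩
    h zero + 0#                        ≈⟨ +-identityʳ _ ⟩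
    h zero                             ∎
  Σ-δ {suc n} (suc i) h = begin
    Σ[ suc n ] (λ x → δ (suc i) x ▹ h x)
      ≡⟨ Σ-suc (λ x → δ (suc i) x ▹ h x) ⟩
    0# + Σ[ n ] (λ x → δ (suc i) (suc x) ▹ h (suc x))
      ≈⟨ +-identityˡ _ ⟩
    Σ[ n ] (λ x → δ (suc i) (suc x) ▹ h (suc x))
      ≡⟨ cong sumL (map-cong (λ x → cong (_▹ h (suc x)) (⌊⌋-map′ _ _ (i ≟ x))) (allFin n)) ⟩
    Σ[ n ] (λ x → δ i x ▹ h (suc x))
      ≈⟨ Σ-δ i (h ∘ suc) ⟩
    h (suc i) ∎

  Σ-const : ∀ n a → Σ[ n ] (λ _ → a) ≈ fromℕ n * a
  Σ-const zero    a = ≈-sym (zeroˡ a)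
  Σ-const (suc n) a = begin
    Σ[ suc n ] (λ _ → a)   ≡⟨ Σ-suc {n} (λ _ → a) ⟩
    a + Σ[ n ] (λ _ → a)   ≈⟨ +-cong (≈-sym (*-identityˡ a)) (Σ-const n a) ⟩
    1# * a + fromℕ n * a   ≈⟨ distribʳ a 1# (fromℕ n) ⟨
    (1# + fromℕ n) * a     ∎

  fromℕ-+ : ∀ a b → fromℕ (a ℕ.+ b) ≈ fromℕ a + fromℕ b
  fromℕ-+ zero    b = ≈-sym (+-identityˡ _)
  fromℕ-+ (suc a) b = ≈-trans (+-congˡ (fromℕ-+ a b)) (≈-sym (+-assoc 1# _ _))

  fromℕ-⨁ : (f : Fin n → ℕ) → fromℕ (∑ℕ.⨁ f) ≈ Σ[ n ] (fromℕ ∘ f)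
  fromℕ-⨁ {zero}  f = ≈-refl
  fromℕ-⨁ {suc n} f = begin
    fromℕ (∑ℕ.⨁ f)                            ≡⟨ cong fromℕ (∑ℕ.⨁-suc f) ⟩
    fromℕ (f zero ℕ.+ ∑ℕ.⨁ (f ∘ suc))         ≈⟨ fromℕ-+ (f zero) _ ⟩
    fromℕ (f zero) + fromℕ (∑ℕ.⨁ (f ∘ suc))   ≈⟨ +-congˡ (fromℕ-⨁ (f ∘ suc)) ⟩
    fromℕ (f zero) + Σ[ n ] (fromℕ ∘ f ∘ suc)  ≡⟨ Σ-suc (fromℕ ∘ f) ⟨
    Σ[ suc n ] (fromℕ ∘ f)                     ∎

  choices : (m : ℕ) → List (Maybe (Fin m))
  choices m = nothing ∷ map just (allFin m)

  ∑-choices : ∀ m (h : Maybe (Fin m) → Carrier) → ∑ (choices m) h ≈ h nothing + Σ[ m ] (h ∘ just)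
  ∑-choices m h = +-congˡ (reflexive (∑-map just (allFin m) h))

  ∑-allOutFuns-suc : ∀ n m (g : (Fin (suc n) → Maybe (Fin m)) → Carrier) →
                     ∑ (allOutFuns (suc n) m) g
                       ≈ ∑ (choices m) (λ b → ∑ (allOutFuns n m) (λ f → g (b ∷ᵥ f)))
  ∑-allOutFuns-suc n m g = ≈-trans (∑-concatMap (λ b → map (b ∷ᵥ_) (allOutFuns n m)) (choices m) g)
    (∑-cong (choices m) (λ b → reflexive (∑-map (b ∷ᵥ_) (allOutFuns n m) g)))

  Respects≗ : ∀ {n m} → ((Fin n → Maybe (Fin m)) → Carrier) → Set _
  Respects≗ g = ∀ {p q} → p ≗ q → g p ≈ g q

  ∑-allOutFuns-at : ∀ {n m} (i : Fin n) (g : (Fin n → Maybe (Fin m)) → Carrier) → Respects≗ g →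
                    ∑ (allOutFuns n m) g
                      ≈ ∑ (allOutFuns n m) (λ p → isNothing (p i) ▹ ∑ (choices m) (λ b → g (p [ i ]≔ b)))
  ∑-allOutFuns-at {suc n} {m} zero g resp = begin
    ∑ (allOutFuns (suc n) m) g
      ≈⟨ ∑-allOutFuns-suc n m g ⟩
    ∑ Cs (λ b → ∑ Fs (λ f → g (b ∷ᵥ f)))
      ≈⟨ ∑-comm Fs Cs (λ f b → g (b ∷ᵥ f)) ⟨
    ∑ Fs (λ f → ∑ Cs (λ b → g (b ∷ᵥ f)))
      ≈⟨ ∑-cong Fs (λ f → ∑-cong Cs (λ b → resp λ { zero → refl ; (suc _) → refl })) ⟩
    ∑ Fs (λ f → ∑ Cs (λ b → g ((nothing ∷ᵥ f) [ zero ]≔ b)))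
      ≈⟨ +-identityʳ _ ⟨
    ∑ Fs (λ f → ∑ Cs (λ b → g ((nothing ∷ᵥ f) [ zero ]≔ b))) + 0#
      ≈⟨ +-congˡ (∑-0 (allFin m) (λ _ → ∑-0 Fs (λ _ → ≈-refl))) ⟨
    ∑ Fs (λ f → ∑ Cs (λ b → g ((nothing ∷ᵥ f) [ zero ]≔ b))) + Σ[ m ] (λ _ → ∑ Fs (λ _ → 0#))
      ≈⟨ ∑-choices m _ ⟨
    ∑ Cs (λ c → ∑ Fs (λ f → isNothing c ▹ ∑ Cs (λ b → g ((c ∷ᵥ f) [ zero ]≔ b))))
      ≈⟨ ∑-allOutFuns-suc n m _ ⟨
    ∑ (allOutFuns (suc n) m) (λ p → isNothing (p zero) ▹ ∑ Cs (λ b → g (p [ zero ]≔ b))) ∎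
    where
    Fs : List (Fin n → Maybe (Fin m))
    Fs = allOutFuns n m
    Cs : List (Maybe (Fin m))
    Cs = choices m
  ∑-allOutFuns-at {suc n} {m} (suc i) g resp = begin
    ∑ (allOutFuns (suc n) m) g
      ≈⟨ ∑-allOutFuns-suc n m g ⟩
    ∑ Cs (λ c → ∑ Fs (λ f → g (c ∷ᵥ f)))
      ≈⟨ ∑-cong Cs (λ c → ∑-allOutFuns-at i (λ f → g (c ∷ᵥ f)) (λ f≗f′ → resp (∷-cong c f≗f′))) ⟩
    ∑ Cs (λ c → ∑ Fs (λ f → isNothing (f i) ▹ ∑ Cs (λ b → g (c ∷ᵥ (f [ i ]≔ b)))))
      ≈⟨ ∑-cong Cs (λ c → ∑-cong Fs (λ f → ▹-cong (isNothing (f i)) (λ _ →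
           ∑-cong Cs (λ b → resp λ { zero → refl ; (suc _) → refl })))) ⟩
    ∑ Cs (λ c → ∑ Fs (λ f → isNothing (f i) ▹ ∑ Cs (λ b → g ((c ∷ᵥ f) [ suc i ]≔ b))))
      ≈⟨ ∑-allOutFuns-suc n m _ ⟨
    ∑ (allOutFuns (suc n) m) (λ p → isNothing (p (suc i)) ▹ ∑ Cs (λ b → g (p [ suc i ]≔ b))) ∎
    where
    Fs : List (Fin n → Maybe (Fin m))
    Fs = allOutFuns n m
    Cs : List (Maybe (Fin m))
    Cs = choices m
    ∷-cong : ∀ c {f f′ : Fin n → Maybe (Fin m)} → f ≗ f′ → (c ∷ᵥ f) ≗ (c ∷ᵥ f′)
    ∷-cong c f≗f′ zero    = refl
    ∷-cong c f≗f′ (suc y) = f≗f′ y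

-- Weighted in-forests of a digraph

module Forests {c ℓ} (R : CommutativeRing c ℓ) {n} (A : Digraph n) (w : Weighted.Weights R n) where
  open CommutativeRing R renaming (refl to ≈-refl; sym to ≈-sym; trans to ≈-trans) hiding (zero)
  open Weighted R
  open Sums R
  open import Algebra.Properties.CommutativeSemigroup +-commutativeSemigroup using (xy∙z≈zx∙y)
  open import Algebra.Properties.Group +-group
    using (⁻¹-involutive; x≈y⇒x∙y⁻¹≈ε; x∙y⁻¹≈ε⇒x≈y; identityˡ-unique)
  open import Algebra.Properties.Ring ring using (-‿distribˡ-*; x[y-z]≈xy-xz)
  open import Relation.Binary.Reasoning.Setoid setoid

  module ∏ = Fold *-commutativeMonoid

  arcWeight : Fin n → Maybe (Fin n) → Carrier
  arcWeight x = maybe (w x) 1#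

  weight-step : (p : OutFun n) → ∀ x r → stepOf 1# (allFin n) (weight w p) _ refl x r ≡ arcWeight x (p x) * r
  weight-step p x r with p x
  ... | nothing = refl
  ... | just _  = refl

  weight≡∏ : (p : OutFun n) → weight w p ≡ ∏.⨁ (λ x → arcWeight x (p x))
  weight≡∏ p = foldr-cong (weight-step p) refl (allFin n)

  weight-attach : (p : OutFun n) {i : Fin n} → p i ≡ nothing → ∀ m →
                  weight w (p [ i ]≔ just m) ≈ w i m * weight w p
  weight-attach p {i} pᵢ m = begin
    weight w (p [ i ]≔ just m)
      ≡⟨ weight≡∏ (p [ i ]≔ just m) ⟩
    ∏.⨁ (λ x → arcWeight x ((p [ i ]≔ just m) x))
      ≈⟨ ∏.⨁-update arcWeight p i (just m) (reflexive (cong (arcWeight i) pᵢ)) ⟩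
    w i m * ∏.⨁ (λ x → arcWeight x (p x))
      ≡⟨ cong (w i m *_) (weight≡∏ p) ⟨
    w i m * weight w p ∎

  weight-cong : {p q : OutFun n} → p ≗ q → weight w p ≡ weight w q
  weight-cong {p} {q} p≗q =
    trans (weight≡∏ p) (trans (∏.⨁-cong (λ x → cong (arcWeight x) (p≗q x))) (sym (weight≡∏ q)))

  roots+arcs : (p : OutFun n) → Σ[ n ] (λ x → isNothing (p x) ▹ 1#) + fromℕ (countArcs p) ≈ fromℕ n
  roots+arcs p = begin
    Σ[ n ] (λ x → isNothing (p x) ▹ 1#) + fromℕ (countArcs p)
      ≈⟨ +-congˡ (≈-trans (reflexive (cong fromℕ (countArcs≡⨁ p))) (fromℕ-⨁ (arcCount ∘ p))) ⟩
    Σ[ n ] (λ x → isNothing (p x) ▹ 1#) + Σ[ n ] (λ x → fromℕ (arcCount (p x)))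
      ≈⟨ ∑-+ (allFin n) _ _ ⟨
    Σ[ n ] (λ x → (isNothing (p x) ▹ 1#) + fromℕ (arcCount (p x)))
      ≈⟨ ∑-cong (allFin n) (λ x → one (p x)) ⟩
    Σ[ n ] (λ _ → 1#)
      ≈⟨ Σ-const n 1# ⟩
    fromℕ n * 1#
      ≈⟨ *-identityʳ _ ⟩
    fromℕ n ∎
    where
    one : (b : Maybe (Fin n)) → (isNothing b ▹ 1#) + fromℕ (arcCount b) ≈ 1#
    one nothing  = +-identityʳ 1#
    one (just _) = ≈-trans (+-identityˡ _) (+-identityʳ 1#)

  offDiag : Fin n → Fin n → Carrier
  offDiag i x = if δ i x then 0# else W A w i x

  -Laplacian-row : ∀ i (y : Fin n → Carrier) →
                   Σ[ n ] (λ x → - Laplacian A w i x * y x) ≈ Σ[ n ] (λ x → offDiag i x * (y x - y i))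
  -Laplacian-row i y = begin
    Σ[ n ] (λ x → - Laplacian A w i x * y x)
      ≈⟨ ∑-cong (allFin n) split ⟩
    Σ[ n ] (λ x → (δ i x ▹ - D * y x) + offDiag i x * y x)
      ≈⟨ ∑-+ (allFin n) _ _ ⟩
    Σ[ n ] (λ x → δ i x ▹ - D * y x) + Σ[ n ] (λ x → offDiag i x * y x)
      ≈⟨ +-congʳ (Σ-δ i (λ x → - D * y x)) ⟩
    - D * y i + Σ[ n ] (λ x → offDiag i x * y x)
      ≈⟨ +-comm _ _ ⟩
    Σ[ n ] (λ x → offDiag i x * y x) + - D * y i
      ≈⟨ +-congˡ (≈-trans (-‿cong (∑-*ʳ (allFin n) (y i) (offDiag i))) (-‿distribˡ-* D (y i))) ⟨
    Σ[ n ] (λ x → offDiag i x * y x) - Σ[ n ] (λ x → offDiag i x * y i)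
      ≈⟨ +-congˡ (∑-neg (allFin n) _) ⟨
    Σ[ n ] (λ x → offDiag i x * y x) + Σ[ n ] (λ x → - (offDiag i x * y i))
      ≈⟨ ∑-+ (allFin n) _ _ ⟨
    Σ[ n ] (λ x → offDiag i x * y x - offDiag i x * y i)
      ≈⟨ ∑-cong (allFin n) (λ x → x[y-z]≈xy-xz (offDiag i x) (y x) (y i)) ⟨
    Σ[ n ] (λ x → offDiag i x * (y x - y i)) ∎
    where
    D : Carrier
    D = Σ[ n ] (offDiag i)
    split : ∀ x → - Laplacian A w i x * y x ≈ (δ i x ▹ - D * y x) + offDiag i x * y x
    split x with δ i x
    ... | true  = ≈-sym (≈-trans (+-congˡ (zeroˡ (y x))) (+-identityʳ _))
    ... | false = ≈-trans (*-congʳ (⁻¹-involutive _)) (≈-sym (+-identityˡ _))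

  inForestᵇ : ℕ → OutFun n → Bool
  inForestᵇ k q = isInForestᵇ A q ∧ (countArcs q ℕ.≡ᵇ k)

  inForestᵇ-cong : ∀ k {q q′ : OutFun n} → q ≗ q′ → inForestᵇ k q ≡ inForestᵇ k q′
  inForestᵇ-cong k q≗q′ =
    cong₂ (λ a c → a ∧ (c ℕ.≡ᵇ k)) (isInForestᵇ-cong q≗q′ A) (countArcs-cong q≗q′)

  rootTerm : ℕ → Fin n → Fin n → OutFun n → Carrier
  rootTerm k x j q = inForestᵇ k q ▹ δ (root q x) j ▹ weight w q

  rootTerm-cong : ∀ k x j {q q′ : OutFun n} → q ≗ q′ → rootTerm k x j q ≡ rootTerm k x j q′
  rootTerm-cong k x j q≗q′ rewrite inForestᵇ-cong k q≗q′ | root-cong q≗q′ x | weight-cong q≗q′ = refl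

  Q≈∑ : ∀ k x j → Q A w k x j ≈ ∑ (allOutFuns n n) (rootTerm k x j)
  Q≈∑ k x j = ≈-trans (∑-filterᵇ (λ q → δ (root q x) j) (inForests A k) (weight w))
                      (∑-filterᵇ (inForestᵇ k) (allOutFuns n n) _)

  σ≈∑ : ∀ k → σ A w k ≈ ∑ (allOutFuns n n) (λ q → inForestᵇ k q ▹ weight w q)
  σ≈∑ k = ∑-filterᵇ (inForestᵇ k) (allOutFuns n n) (weight w)

  rowLhs rowRhs : ℕ → Fin n → Fin n → OutFun n → Carrier
  rowLhs k i j = rootTerm (suc k) i j
  rowRhs k i j q =
    Σ[ n ] (λ x → - Laplacian A w i x * rootTerm k x j q) + (δ i j ▹ inForestᵇ (suc k) q ▹ weight w q)

  rowRhs-cong : ∀ k i j → Respects≗ (rowRhs k i j)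
  rowRhs-cong k i j q≗q′ = +-cong
    (∑-cong (allFin n) (λ x → *-congˡ (reflexive (rootTerm-cong k x j q≗q′))))
    (reflexive (cong₂ (λ b v → δ i j ▹ b ▹ v) (inForestᵇ-cong (suc k) q≗q′) (weight-cong q≗q′)))

  module Attach (p : OutFun n) {i : Fin n} (pᵢ : p i ≡ nothing) where

    att : Fin n → Bool
    att = attachableᵇ A p i

    extendableᵇ : ℕ → Bool
    extendableᵇ k = isInForestᵇ A p ∧ (suc (countArcs p) ℕ.≡ᵇ k)

    inForestᵇ-attach : ∀ k m → inForestᵇ k (p [ i ]≔ just m) ≡ extendableᵇ k ∧ att m
    inForestᵇ-attach k m =
      trans (cong₂ (λ a c → a ∧ (c ℕ.≡ᵇ k)) (isInForestᵇ-attach A p pᵢ m) (countArcs-attach p pᵢ m))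
            (xy∙z≈xz∙y (isInForestᵇ A p) (att m) _)
      where
      open import Algebra.Properties.CommutativeSemigroup
        (CommutativeMonoid.commutativeSemigroup ∧-commutativeMonoid) using (xy∙z≈xz∙y)

    rootᵢ : root p i ≡ i
    rootᵢ = root-of-sink p pᵢ

    att-self : att i ≡ false
    att-self with root p i ≟ i
    ... | yes _    = ∧-zeroʳ (A i i)
    ... | no rᵢ≢i = ⊥-elim (rᵢ≢i rootᵢ)

    reroot-i : ∀ m → reroot p pᵢ m i ≡ root p m
    reroot-i m rewrite rootᵢ with i ≟ i
    ... | yes _   = refl
    ... | no i≢i = ⊥-elim (i≢i refl)

    reroot-to-i : ∀ m {x} → root p x ≡ i → reroot p pᵢ m x ≡ root p m
    reroot-to-i m {x} rₓ≡i with root p x ≟ i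
    ... | yes _    = refl
    ... | no rₓ≢i = ⊥-elim (rₓ≢i rₓ≡i)

    reroot-attachable : ∀ m {x} → T (att x) → reroot p pᵢ m x ≡ root p x
    reroot-attachable m {x} tₓ with root p x ≟ i | attachable⇒root≢ A p tₓ
    ... | yes rₓ≡i | rₓ≢i = ⊥-elim (rₓ≢i rₓ≡i)
    ... | no _     | _    = refl

    root-attachable : ∀ {m} → T (isInForestᵇ A p) → T (att m) →
                      ∀ x → root (p [ i ]≔ just m) x ≡ reroot p pᵢ m x
    root-attachable {m} forest tₘ =
      root-attach p pᵢ m (isInForestᵇ⇒Acyclic A p forest) (attachable⇒root≢ A p tₘ)

    rootTerm-attach : ∀ k x j m → rootTerm k x j (p [ i ]≔ just m)
                                    ≈ (extendableᵇ k ∧ att m) ▹ δ (reroot p pᵢ m x) j ▹ w i m * weight w p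
    rootTerm-attach k x j m rewrite inForestᵇ-attach k m = ▹-cong (extendableᵇ k ∧ att m) λ t →
      let (tₖ , tₘ) = T-∧ .to t in
      ≈-trans (reflexive (cong (λ r → δ r j ▹ weight w (p [ i ]≔ just m))
                               (root-attachable (proj₁ (T-∧ .to tₖ)) tₘ x)))
              (▹-cong _ (λ _ → weight-attach p pᵢ m))

    offDiag-attachable : ∀ x {d} → (root p x ≡ i → d ≈ 0#) → offDiag i x * d ≈ att x ▹ w i x * d
    offDiag-attachable x {d} d≈0 with i ≟ x
    ... | yes refl = ≈-trans (zeroˡ d) (reflexive (cong (_▹ w i i * d) (sym att-self)))
    ... | no _ with A i x
    ...   | false = zeroˡ d
    ...   | true with root p x ≟ i
    ...     | yes rₓ≡i = ≈-trans (*-congˡ (d≈0 rₓ≡i)) (zeroʳ _)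
    ...     | no _     = ≈-refl

    -Laplacian-row-attachable : ∀ (y : Fin n → Carrier) → (∀ x → root p x ≡ i → y x ≈ y i) →
      Σ[ n ] (λ x → - Laplacian A w i x * y x) ≈ Σ[ n ] (λ x → att x ▹ w i x * (y x - y i))
    -Laplacian-row-attachable y y≈yᵢ = ≈-trans (-Laplacian-row i y)
      (∑-cong (allFin n) (λ x → offDiag-attachable x (λ rₓ≡i → x≈y⇒x∙y⁻¹≈ε (y≈yᵢ x rₓ≡i))))

    -- diag₀ and lap₀ are the diagonal and Laplacian parts of the (i, j) entry contributed by p,
    -- rooted m, diag m and lap m those contributed by p [ i ]≔ just m, each without its guard.
    module _ (k : ℕ) (j : Fin n) where

      W₀ : Carrier
      W₀ = weight w p

      diag₀ lap₀ : Carrier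
      diag₀ = δ i j ▹ inForestᵇ (suc k) p ▹ W₀
      lap₀  = Σ[ n ] (λ x → att x ▹ w i x * ((δ (root p x) j ▹ W₀) - (δ i j ▹ W₀)))

      lapTerm : Fin n → Fin n → Carrier
      lapTerm m x = w i x * ((δ (reroot p pᵢ m x) j ▹ w i m * W₀) - (δ (root p m) j ▹ w i m * W₀))

      rooted diag lap : Fin n → Carrier
      rooted m = att m ▹ δ (root p m) j ▹ w i m * W₀
      diag m   = δ i j ▹ att m ▹ w i m * W₀
      lap m    = Σ[ n ] (λ x → att x ▹ lapTerm m x)

      rootTerm-at-root : rowLhs k i j p ≡ diag₀
      rootTerm-at-root =
        trans (cong (λ r → inForestᵇ (suc k) p ▹ δ r j ▹ W₀) rootᵢ) (▹-comm (inForestᵇ (suc k) p) (δ i j) W₀)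

      rootTerm-attach-at-root : ∀ m → rowLhs k i j (p [ i ]≔ just m) ≈ inForestᵇ k p ▹ rooted m
      rootTerm-attach-at-root m = ≈-trans (rootTerm-attach (suc k) i j m) (reflexive
        (trans (▹-∧ (inForestᵇ k p) (att m) _)
               (cong (λ r → inForestᵇ k p ▹ att m ▹ δ r j ▹ w i m * W₀) (reroot-i m))))

      laplacian-rootTerm : Σ[ n ] (λ x → - Laplacian A w i x * rootTerm k x j p) ≈ inForestᵇ k p ▹ lap₀
      laplacian-rootTerm = ≈-trans (∑-*-▹ (allFin n) (inForestᵇ k p) _ y) (▹-cong (inForestᵇ k p) λ _ →
        ≈-trans (-Laplacian-row-attachable y (λ x rₓ≡i → reflexive (cong y′ (trans rₓ≡i (sym rootᵢ)))))
                (∑-cong (allFin n) (λ x → reflexive (cong (λ r → att x ▹ w i x * (y x - y′ r)) rootᵢ))))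
        where
        y′ : Fin n → Carrier
        y′ r = δ r j ▹ W₀
        y : Fin n → Carrier
        y x = y′ (root p x)

      laplacian-rootTerm-attach : ∀ m → Σ[ n ] (λ x → - Laplacian A w i x * rootTerm k x j (p [ i ]≔ just m))
                                          ≈ extendableᵇ k ▹ att m ▹ lap m
      laplacian-rootTerm-attach m = begin
        Σ[ n ] (λ x → - Laplacian A w i x * rootTerm k x j (p [ i ]≔ just m))
          ≈⟨ ∑-cong (allFin n) (λ x → *-congˡ (rootTerm-attach k x j m)) ⟩
        Σ[ n ] (λ x → - Laplacian A w i x * (guard ▹ y x))
          ≈⟨ ∑-*-▹ (allFin n) guard _ y ⟩
        guard ▹ Σ[ n ] (λ x → - Laplacian A w i x * y x)
          ≈⟨ ▹-cong guard (λ _ → -Laplacian-row-attachable y y≈yᵢ) ⟩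
        guard ▹ Σ[ n ] (λ x → att x ▹ w i x * (y x - y i))
          ≡⟨ ▹-∧ (extendableᵇ k) (att m) _ ⟩
        extendableᵇ k ▹ att m ▹ Σ[ n ] (λ x → att x ▹ w i x * (y x - y i))
          ≡⟨ cong (λ r → extendableᵇ k ▹ att m ▹ Σ[ n ] (λ x → att x ▹ w i x * (y x - y′ r))) (reroot-i m) ⟩
        extendableᵇ k ▹ att m ▹ lap m ∎
        where
        guard : Bool
        guard = extendableᵇ k ∧ att m
        y′ : Fin n → Carrier
        y′ r = δ r j ▹ w i m * W₀
        y : Fin n → Carrier
        y x = y′ (reroot p pᵢ m x)
        y≈yᵢ : ∀ x → root p x ≡ i → y x ≈ y i
        y≈yᵢ x rₓ≡i = reflexive (cong y′ (trans (reroot-to-i m rₓ≡i) (sym (reroot-i m))))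

      diagonalTerm-attach : ∀ m → (δ i j ▹ inForestᵇ (suc k) (p [ i ]≔ just m) ▹ weight w (p [ i ]≔ just m))
                                  ≈ inForestᵇ k p ▹ diag m
      diagonalTerm-attach m rewrite inForestᵇ-attach (suc k) m =
        ≈-trans (▹-cong (δ i j) (λ _ → ▹-cong (inForestᵇ k p ∧ att m) (λ _ → weight-attach p pᵢ m)))
                (reflexive (trans (cong (δ i j ▹_) (▹-∧ (inForestᵇ k p) (att m) _))
                                  (▹-comm (δ i j) (inForestᵇ k p) _)))

      ∑-rooted : Σ[ n ] rooted ≈ lap₀ + Σ[ n ] diag
      ∑-rooted = ≈-trans (∑-cong (allFin n) split) (∑-+ (allFin n) _ diag)
        where
        split : ∀ m → rooted m ≈ (att m ▹ w i m * ((δ (root p m) j ▹ W₀) - (δ i j ▹ W₀))) + diag m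
        split m with att m
        ... | true  = ▹-split (δ (root p m) j) (δ i j) (w i m) W₀
        ... | false = ≈-sym (≈-trans (+-congˡ (reflexive (▹-0 (δ i j)))) (+-identityʳ 0#))

      ∑-lap≈0 : Σ[ n ] (λ m → att m ▹ lap m) ≈ 0#
      ∑-lap≈0 = begin
        Σ[ n ] (λ m → att m ▹ lap m)
          ≈⟨ ∑-cong (allFin n) (λ m → ∑-▹ (allFin n) (att m) _) ⟨
        Σ[ n ] (λ m → Σ[ n ] (λ x → att m ▹ att x ▹ lapTerm m x))
          ≈⟨ ∑-cong (allFin n) (λ m → ∑-cong (allFin n) (term m)) ⟩
        Σ[ n ] (λ m → Σ[ n ] (λ x → f m x * (b x - b m)))
          ≈⟨ ∑-antisymmetric (allFin n) f b f-sym ⟩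
        0# ∎
        where
        f : Fin n → Fin n → Carrier
        f m x = (att m ▹ att x ▹ w i m * w i x) * W₀
        b : Fin n → Carrier
        b t = δ (root p t) j ▹ 1#
        f-sym : ∀ m x → f m x ≈ f x m
        f-sym m x with att m | att x
        ... | true  | true  = *-congʳ (*-comm (w i m) (w i x))
        ... | true  | false = ≈-refl
        ... | false | true  = ≈-refl
        ... | false | false = ≈-refl
        term : ∀ m x → (att m ▹ att x ▹ lapTerm m x) ≈ f m x * (b x - b m)
        term m x with att m | att x in eqₓ
        ... | false | _     = ≈-sym (≈-trans (*-congʳ (zeroˡ W₀)) (zeroˡ _))
        ... | true  | false = ≈-sym (≈-trans (*-congʳ (zeroˡ W₀)) (zeroˡ _))
        ... | true  | true  rewrite reroot-attachable m (T-≡ .from eqₓ) =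
          ▹-difference (δ (root p x) j) (δ (root p m) j) (w i x) (w i m) W₀

      p₀≗p : (p [ i ]≔ nothing) ≗ p
      p₀≗p = updateAt-id-local i p (sym pᵢ)

      ∑-rowLhs-at : ∑ (choices n) (λ b → rowLhs k i j (p [ i ]≔ b))
                      ≈ diag₀ + ((inForestᵇ k p ▹ lap₀) + (inForestᵇ k p ▹ Σ[ n ] diag))
      ∑-rowLhs-at = begin
        ∑ (choices n) (λ b → rowLhs k i j (p [ i ]≔ b))
          ≈⟨ ∑-choices n _ ⟩
        rowLhs k i j (p [ i ]≔ nothing) + Σ[ n ] (λ m → rowLhs k i j (p [ i ]≔ just m))
          ≈⟨ +-cong (reflexive (trans (rootTerm-cong (suc k) i j p₀≗p) rootTerm-at-root))
                    (∑-cong (allFin n) rootTerm-attach-at-root) ⟩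
        diag₀ + Σ[ n ] (λ m → inForestᵇ k p ▹ rooted m)
          ≈⟨ +-congˡ (∑-▹ (allFin n) (inForestᵇ k p) rooted) ⟩
        diag₀ + (inForestᵇ k p ▹ Σ[ n ] rooted)
          ≈⟨ +-congˡ (▹-cong (inForestᵇ k p) (λ _ → ∑-rooted)) ⟩
        diag₀ + (inForestᵇ k p ▹ lap₀ + Σ[ n ] diag)
          ≈⟨ +-congˡ (▹-+ (inForestᵇ k p) lap₀ _) ⟩
        diag₀ + ((inForestᵇ k p ▹ lap₀) + (inForestᵇ k p ▹ Σ[ n ] diag)) ∎

      ∑-rowRhs-at : ∑ (choices n) (λ b → rowRhs k i j (p [ i ]≔ b))
                      ≈ diag₀ + ((inForestᵇ k p ▹ lap₀) + (inForestᵇ k p ▹ Σ[ n ] diag))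
      ∑-rowRhs-at = begin
        ∑ (choices n) (λ b → rowRhs k i j (p [ i ]≔ b))
          ≈⟨ ∑-choices n _ ⟩
        rowRhs k i j (p [ i ]≔ nothing) + Σ[ n ] (λ m → rowRhs k i j (p [ i ]≔ just m))
          ≈⟨ +-cong (≈-trans (rowRhs-cong k i j p₀≗p) (+-congʳ laplacian-rootTerm))
                    (∑-cong (allFin n) (λ m → +-cong (laplacian-rootTerm-attach m) (diagonalTerm-attach m))) ⟩
        (F▹lap₀ + diag₀) + Σ[ n ] (λ m → (extendableᵇ k ▹ att m ▹ lap m) + (inForestᵇ k p ▹ diag m))
          ≈⟨ +-congˡ (∑-+ (allFin n) _ _) ⟩
        (F▹lap₀ + diag₀) + (Σ[ n ] (λ m → extendableᵇ k ▹ att m ▹ lap m)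
                             + Σ[ n ] (λ m → inForestᵇ k p ▹ diag m))
          ≈⟨ +-congˡ (+-cong (≈-trans (∑-▹ (allFin n) (extendableᵇ k) _)
                                      (▹-cong (extendableᵇ k) (λ _ → ∑-lap≈0)))
                             (∑-▹ (allFin n) (inForestᵇ k p) diag)) ⟩
        (F▹lap₀ + diag₀) + ((extendableᵇ k ▹ 0#) + (inForestᵇ k p ▹ Σ[ n ] diag))
          ≈⟨ +-congˡ (≈-trans (+-congʳ (reflexive (▹-0 (extendableᵇ k)))) (+-identityˡ _)) ⟩
        (F▹lap₀ + diag₀) + (inForestᵇ k p ▹ Σ[ n ] diag)
          ≈⟨ ≈-trans (+-congʳ (+-comm F▹lap₀ diag₀)) (+-assoc diag₀ _ _) ⟩
        diag₀ + (F▹lap₀ + (inForestᵇ k p ▹ Σ[ n ] diag)) ∎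
        where
        F▹lap₀ : Carrier
        F▹lap₀ = inForestᵇ k p ▹ lap₀

      ∑-row-at : ∑ (choices n) (λ b → rowLhs k i j (p [ i ]≔ b))
                   ≈ ∑ (choices n) (λ b → rowRhs k i j (p [ i ]≔ b))
      ∑-row-at = ≈-trans ∑-rowLhs-at (≈-sym ∑-rowRhs-at)

  row-identity : ∀ k i j →
                 Q A w (suc k) i j ≈ Σ[ n ] (λ m → - Laplacian A w i m * Q A w k m j) + σ A w (suc k) * I i j
  row-identity k i j = begin
    Q A w (suc k) i j
      ≈⟨ Q≈∑ (suc k) i j ⟩
    ∑ Fs (rowLhs k i j)
      ≈⟨ ∑-allOutFuns-at i (rowLhs k i j) (λ q≗q′ → reflexive (rootTerm-cong (suc k) i j q≗q′)) ⟩
    ∑ Fs (λ p → isNothing (p i) ▹ ∑ (choices n) (λ b → rowLhs k i j (p [ i ]≔ b)))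
      ≈⟨ ∑-cong Fs (λ p → ▹-cong (isNothing (p i)) (λ t → Attach.∑-row-at p (T-isNothing .to t) k j)) ⟩
    ∑ Fs (λ p → isNothing (p i) ▹ ∑ (choices n) (λ b → rowRhs k i j (p [ i ]≔ b)))
      ≈⟨ ∑-allOutFuns-at i (rowRhs k i j) (rowRhs-cong k i j) ⟨
    ∑ Fs (rowRhs k i j)
      ≈⟨ ∑-+ Fs _ _ ⟩
    ∑ Fs (λ q → Σ[ n ] (λ m → - Laplacian A w i m * rootTerm k m j q))
      + ∑ Fs (λ q → δ i j ▹ inForestᵇ (suc k) q ▹ weight w q)
      ≈⟨ +-cong laplacian-part diagonal-part ⟩
    Σ[ n ] (λ m → - Laplacian A w i m * Q A w k m j) + σ A w (suc k) * I i j ∎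
    where
    Fs : List (OutFun n)
    Fs = allOutFuns n n
    laplacian-part : ∑ Fs (λ q → Σ[ n ] (λ m → - Laplacian A w i m * rootTerm k m j q))
                       ≈ Σ[ n ] (λ m → - Laplacian A w i m * Q A w k m j)
    laplacian-part = ≈-trans (∑-comm Fs (allFin n) _) (∑-cong (allFin n) λ m →
      ≈-trans (∑-*ˡ Fs _ _) (*-congˡ (≈-sym (Q≈∑ k m j))))
    diagonal-part : ∑ Fs (λ q → δ i j ▹ inForestᵇ (suc k) q ▹ weight w q) ≈ σ A w (suc k) * I i j
    diagonal-part = ≈-trans (∑-▹ Fs (δ i j) _)
                            (≈-trans (▹-cong (δ i j) (λ _ → ≈-sym (σ≈∑ (suc k)))) (▹-1 (δ i j) _))

  forest-roots : ∀ q → T (isInForestᵇ A q) → ∀ v →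
                 Σ[ n ] (λ x → δ (root q x) x ▹ v) + fromℕ (countArcs q) * v ≈ fromℕ n * v
  forest-roots q forest v = begin
    Σ[ n ] (λ x → δ (root q x) x ▹ v) + fromℕ (countArcs q) * v
      ≈⟨ +-cong (∑-cong (allFin n) (λ x → reflexive (cong (_▹ v) (root-fixed⇔sink q ac x)))) (*-comm _ v) ⟩
    Σ[ n ] (λ x → isNothing (q x) ▹ v) + v * fromℕ (countArcs q)
      ≈⟨ +-congʳ (≈-trans (∑-cong (allFin n) (λ x → ▹-1 (isNothing (q x)) v)) (∑-*ˡ (allFin n) v _)) ⟩
    v * Σ[ n ] (λ x → isNothing (q x) ▹ 1#) + v * fromℕ (countArcs q)
      ≈⟨ distribˡ v _ _ ⟨
    v * (Σ[ n ] (λ x → isNothing (q x) ▹ 1#) + fromℕ (countArcs q))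
      ≈⟨ *-congˡ (roots+arcs q) ⟩
    v * fromℕ n
      ≈⟨ *-comm v _ ⟩
    fromℕ n * v ∎
    where
    ac : Acyclic q
    ac = isInForestᵇ⇒Acyclic A q forest

  rootTerms : ∀ k q → Σ[ n ] (λ x → rootTerm k x x q) + fromℕ k * (inForestᵇ k q ▹ weight w q)
                        ≈ fromℕ n * (inForestᵇ k q ▹ weight w q)
  rootTerms k q = begin
    Σ[ n ] (λ x → rootTerm k x x q) + fromℕ k * (F ▹ weight w q)
      ≈⟨ +-cong (∑-▹ (allFin n) F _) (▹-*ˡ F _ _) ⟩
    (F ▹ Σ[ n ] (λ x → δ (root q x) x ▹ weight w q)) + (F ▹ fromℕ k * weight w q)
      ≈⟨ ▹-+ F _ _ ⟨
    F ▹ Σ[ n ] (λ x → δ (root q x) x ▹ weight w q) + fromℕ k * weight w q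
      ≈⟨ ▹-cong F forest-case ⟩
    F ▹ fromℕ n * weight w q
      ≈⟨ ▹-*ˡ F _ _ ⟨
    fromℕ n * (F ▹ weight w q) ∎
    where
    F : Bool
    F = inForestᵇ k q
    forest-case : T F → Σ[ n ] (λ x → δ (root q x) x ▹ weight w q) + fromℕ k * weight w q
                          ≈ fromℕ n * weight w q
    forest-case t with T-∧ {isInForestᵇ A q} .to t
    ... | forest , arcs≡k rewrite sym (≡ᵇ⇒≡ (countArcs q) k arcs≡k) = forest-roots q forest (weight w q)

  diagonal-sum : ∀ k → Σ[ n ] (λ x → Q A w k x x) + fromℕ k * σ A w k ≈ fromℕ n * σ A w k
  diagonal-sum k = begin
    Σ[ n ] (λ x → Q A w k x x) + fromℕ k * σ A w k
      ≈⟨ +-cong (∑-cong (allFin n) (λ x → Q≈∑ k x x)) (*-congˡ (σ≈∑ k)) ⟩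
    Σ[ n ] (λ x → ∑ Fs (rootTerm k x x)) + fromℕ k * ∑ Fs F
      ≈⟨ +-cong (∑-comm Fs (allFin n) _) (∑-*ˡ Fs _ F) ⟨
    ∑ Fs (λ q → Σ[ n ] (λ x → rootTerm k x x q)) + ∑ Fs (λ q → fromℕ k * F q)
      ≈⟨ ∑-+ Fs _ _ ⟨
    ∑ Fs (λ q → Σ[ n ] (λ x → rootTerm k x x q) + fromℕ k * F q)
      ≈⟨ ∑-cong Fs (rootTerms k) ⟩
    ∑ Fs (λ q → fromℕ n * F q)
      ≈⟨ ∑-*ˡ Fs _ F ⟩
    fromℕ n * ∑ Fs F
      ≈⟨ *-congˡ (σ≈∑ k) ⟨
    fromℕ n * σ A w k ∎
    where
    Fs : List (OutFun n)
    Fs = allOutFuns n n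
    F : OutFun n → Carrier
    F q = inForestᵇ k q ▹ weight w q

  diagonal-row : ∀ k i → Q A w (suc k) i i ≈ - (Laplacian A w ⊗ Q A w k) i i + σ A w (suc k)
  diagonal-row k i = ≈-trans (row-identity k i i) (+-cong
    (≈-trans (∑-cong (allFin n) (λ m → ≈-sym (-‿distribˡ-* _ _))) (∑-neg (allFin n) _))
    (≈-trans (*-congˡ (reflexive (cong (_▹ 1#) (trans (isYes≗does (i ≟ i)) (dec-true (i ≟ i) refl)))))
             (*-identityʳ _)))

  trace-identity : ∀ k → fromℕ (suc k) * σ A w (suc k) ≈ tr (Laplacian A w ⊗ Q A w k)
  trace-identity k = x∙y⁻¹≈ε⇒x≈y K τ (identityˡ-unique (K - τ) S (begin
    (K - τ) + S                           ≈⟨ xy∙z≈zx∙y (- τ) S K ⟨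
    (- τ + S) + K                         ≈⟨ +-congʳ diagonal-trace ⟨
    Σ[ n ] (λ x → Q A w (suc k) x x) + K  ≈⟨ diagonal-sum (suc k) ⟩
    S                                     ∎))
    where
    τ K S : Carrier
    τ = tr (Laplacian A w ⊗ Q A w k)
    K = fromℕ (suc k) * σ A w (suc k)
    S = fromℕ n * σ A w (suc k)
    diagonal-trace : Σ[ n ] (λ x → Q A w (suc k) x x) ≈ - τ + S
    diagonal-trace = ≈-trans (∑-cong (allFin n) (diagonal-row k))
      (≈-trans (∑-+ (allFin n) _ _) (+-cong (∑-neg (allFin n) _) (Σ-const n _)))

proposition4 : ∀ {c ℓ} (R : CommutativeRing c ℓ) →
    let open CommutativeRing R in
    let open Weighted R in
    (n : ℕ) → 1 < n → (A : Digraph n) → Loopless A → (w : Weights n) →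
    (k : ℕ) →
      ((i j : Fin n) →
        Q A w (suc k) i j
          ≈ (neg (Laplacian A w) ⊗ Q A w k ⊕ scal (σ A w (suc k)) I) i j)
      × (fromℕ (suc k) * σ A w (suc k) ≈ tr (Laplacian A w ⊗ Q A w k))
proposition4 R n _ A _ w k = (λ i j → row-identity k i j) , trace-identity k
  where open Forests R A w
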